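{- Let $\mathscr{S} = (S,\theta,s^{\circ})$ be a feature transition system and let $s,t \in S$. Then $s$ and $t$ are branching feature bisimilar with respect to $\mathscr{S}$ (i.e. $s \simeq_{bf} t$) if and only if, for every product $P \in \mathscr{P}$, $s$ and $t$ are branching bisimilar states of the projected labeled transition system $\mathscr{S}_P$.
   Context: Fix a finite non-empty set $\mathscr{F}$ of features, a set of products $\mathscr{P} \subseteq 2^{\mathscr{F}}$, a set of actions $\mathscr{A}$, a silent action $\tau \notin \mathscr{A}$, and $\mathscr{A}_\tau = \mathscr{A} \cup \{\tau\}$. $\mathbb{B}(\mathscr{F})$ denotes the set of Boolean expressions over $\mathscr{F}$ (feature expressions). For $P \in \mathscr{P}$ and $\varphi \in \mathbb{B}(\mathscr{F})$, $P \models \varphi$ means $\varphi$ evaluates to true when features in $P$ are set true and the others false. $\varphi \sim_{\mathscr{P}} \psi$ iff for all $P\in\mathscr{P}$, $P\models\varphi \Leftrightarrow P\models\psi$; $\widehat{\mathbb{B}(\mathscr{F})} = \mathbb{B}(\mathscr{F})/{\sim_{\mathscr{P}}}$ and $\hat\varphi$ is the class of $\varphi$. A feature transition system (FTS) is $\mathscr{S}=(S,\theta,s^\circ)$ with state set $S$, transition constraint function $\theta : S\times\mathscr{A}_\tau\times S \to \mathbb{B}(\mathscr{F})$ and initial state $s^\circ\in S$. Write $s \xrightarrow{\alpha|\psi} s'$ if $\theta(s,\alpha,s')=\psi$ and $\psi$ is satisfiable. Write $s \Rightarrow_{\eta} s'$ ($\eta$ satisfiable) if there are $n\ge 0$, states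 $s=s_0,\dots,s_n=s'$ and $\eta_1,\dots,\eta_n$ with $s_{i-1}\xrightarrow{\tau|\eta_i} s_i$ for all $i$ and $\eta=\bigwedge_{i}\eta_i$. Write $s \xrightarrow{(\alpha|\psi)} s'$ if $s\xrightarrow{\alpha|\psi}s'$, or $\alpha=\tau$, $s=s'$ and $\psi=\mathit{true}$. A symmetric relation $R\subseteq S\times\widehat{\mathbb{B}(\mathscr{F})}\times S$ is a branching feature bisimulation relation for $\mathscr{S}$ if whenever $R(s,\hat\varphi,t)$ and $s\xrightarrow{\alpha|\psi}s'$, there exist $n$ and, for $i=1,\dots,n$, states $\hat t_i,t'_i$ and feature expressions $\eta_i,\psi_i,\varphi_i,\varphi'_i$ such that $t\Rightarrow_{\eta_i}\hat t_i\xrightarrow{(\alpha|\psi_i)} t'_i$, $R(s,\hat\varphi_i,\hat t_i)$, $R(s',\hat\varphi'_i,t'_i)$ for all $i$, and for all $P\in\mathscr{P}$: $P\models\varphi\wedge\psi$ implies $P\models\bigvee_{1\le i\le n}(\eta_i\wedge\psi_i\wedge\varphi_i\wedge\varphi'_i)$. States $s,t$ are branching feature bisimilar, $s\simeq_{bf} t$, if $R(s,\widehat{\mathit{true}},t)$ for some such $R$. For $P\in\mathscr{P}$, the projection $\mathscr{S}_P$ is the labeled transition system $(S,\to_P,s^\circ)$ where $s\xrightarrow{\alpha}_P s'$ iff $s\xrightarrow{\alpha|\psi}s'$ for some $\psi$ with $P\models\psi$. For a labeled transition system $(S,\to,s^\circ)$ over $\mathscr{A}_\tau$: $s\Rightarrow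 s'$ means $s$ reaches $s'$ by zero or more $\tau$-transitions; $\hat t\xrightarrow{(\alpha)}t'$ means $\hat t\xrightarrow{\alpha}t'$ or ($\alpha=\tau$ and $\hat t=t'$); a symmetric $R\subseteq S\times S$ is a branching bisimulation if whenever $R(s,t)$ and $s\xrightarrow{\alpha}s'$, there are $\hat t,t'$ with $t\Rightarrow\hat t\xrightarrow{(\alpha)}t'$, $R(s,\hat t)$ and $R(s',t')$; $s,t$ are branching bisimilar if $R(s,t)$ for some such $R$. -}

module Defs where

open import Data.Nat using (ℕ; suc; NonZero)
open import Data.Fin using (Fin)
open import Data.Bool using (Bool; true; false; T; _∧_; _∨_; not)
open import Data.Fin.Subset using (Subset)
open import Data.Vec using (lookup)
open import Data.List using (List; []; _∷_; foldr; map)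
open import Data.List.Relation.Unary.All using (All)
open import Data.Product using (Σ; ∃; ∃-syntax; _×_; _,_)
open import Relation.Binary.PropositionalEquality using (_≡_)
open import Function.Bundles using (_⇔_)

data FExp (n : ℕ) : Set where
  fvar        : Fin n → FExp n
  ftrue ffalse : FExp n
  fnot        : FExp n → FExp n
  _fand_ _for_ : FExp n → FExp n → FExp n

infixr 7 _fand_
infixr 6 _for_

Product : ℕ → Set
Product n = Subset n

eval : ∀ {n} → Product n → FExp n → Bool
eval P (fvar f)    = lookup P f
eval P ftrue       = true
eval P ffalse      = false
eval P (fnot φ)    = not (eval P φ)
eval P (φ fand ψ)  = eval P φ ∧ eval P ψ
eval P (φ for ψ)   = eval P φ ∨ eval P ψ

_⊨_ : ∀ {n} → Product n → FExp n → Set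
P ⊨ φ = T (eval P φ)

Sat : ∀ {n} → FExp n → Set
Sat φ = ∃[ Q ] (Q ⊨ φ)

-- a set of products 𝒫 ⊆ 2^F, given by its characteristic function
ProductSet : ℕ → Set
ProductSet n = Product n → Bool

_∈𝒫_ : ∀ {n} → Product n → ProductSet n → Set
P ∈𝒫 𝒫 = T (𝒫 P)

_∼[_]_ : ∀ {n} → FExp n → ProductSet n → FExp n → Set
φ ∼[ 𝒫 ] ψ = ∀ P → P ∈𝒫 𝒫 → (P ⊨ φ ⇔ P ⊨ ψ)

data Actτ (A : Set) : Set where
  τ   : Actτ A
  act : A → Actτ A

record FTS (n : ℕ) (A : Set) : Set₁ where
  field
    S  : Set
    θ  : S → Actτ A → S → FExp n
    s° : S

module FTSDefs {n : ℕ} {A : Set} (𝒮 : FTS n A) where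
  open FTS 𝒮

  _—[_∣_]→_ : S → Actτ A → FExp n → S → Set
  s —[ α ∣ ψ ]→ s' = (θ s α s' ≡ ψ) × Sat ψ

  data TauPath : S → FExp n → S → Set where
    nil  : ∀ {s} → TauPath s ftrue s
    cons : ∀ {s s₁ s' η₁ η} → s —[ τ ∣ η₁ ]→ s₁ → TauPath s₁ η s' →
           TauPath s (η₁ fand η) s'

  _⇒[_]_ : S → FExp n → S → Set
  s ⇒[ η ] s' = TauPath s η s' × Sat η

  data _—⟨_∣_⟩→_ : S → Actτ A → FExp n → S → Set where
    real : ∀ {s α ψ s'} → s —[ α ∣ ψ ]→ s' → s —⟨ α ∣ ψ ⟩→ s'
    idle : ∀ {s} → s —⟨ τ ∣ ftrue ⟩→ s

  -- one matching witness (index i) in the branching feature bisimulation clause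
  record Witness (R : S → FExp n → S → Set) (s : S) (α : Actτ A) (s' t : S) : Set where
    constructor witness
    field
      t̂ t' : S
      η ψ φ φ' : FExp n
      weak : t ⇒[ η ] t̂
      move : t̂ —⟨ α ∣ ψ ⟩→ t'
      rel  : R s φ t̂
      rel' : R s' φ' t'

  wformula : ∀ {R s α s' t} → Witness R s α s' t → FExp n
  wformula w = η fand ψ fand φ fand φ'
    where open Witness w

  ⋁ : List (FExp n) → FExp n
  ⋁ = foldr _for_ ffalse

  -- Relations R ⊆ S × B(F)/∼_𝒫 × S are represented as relations on
  -- expressions that are invariant under ∼_𝒫.
  record IsBranchingFeatureBisim (𝒫 : ProductSet n) (R : S → FExp n → S → Set) : Set where
    field
      respects  : ∀ {s φ φ₂ t} → φ ∼[ 𝒫 ] φ₂ → R s φ t → R s φ₂ t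
      symmetric : ∀ {s φ t} → R s φ t → R t φ s
      transfer  : ∀ {s φ t α ψ s'} → R s φ t → s —[ α ∣ ψ ]→ s' →
                  Σ (List (Witness R s α s' t)) λ ws →
                    ∀ P → P ∈𝒫 𝒫 → P ⊨ (φ fand ψ) → P ⊨ ⋁ (map wformula ws)

  BranchingFeatureBisimilar : ProductSet n → S → S → Set₁
  BranchingFeatureBisimilar 𝒫 s t =
    ∃[ R ] (IsBranchingFeatureBisim 𝒫 R × R s ftrue t)

  _—[_]→[_]_ : S → Actτ A → Product n → S → Set
  s —[ α ]→[ P ] s' = ∃[ ψ ] ((s —[ α ∣ ψ ]→ s') × P ⊨ ψ)

module LTSDefs {A : Set} {S : Set} (_⟶[_]_ : S → Actτ A → S → Set) where

  data _⇒_ : S → S → Set where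
    here  : ∀ {s} → s ⇒ s
    there : ∀ {s s₁ s'} → s ⟶[ τ ] s₁ → s₁ ⇒ s' → s ⇒ s'

  data _⟶⟨_⟩_ : S → Actτ A → S → Set where
    real : ∀ {s α s'} → s ⟶[ α ] s' → s ⟶⟨ α ⟩ s'
    idle : ∀ {s} → s ⟶⟨ τ ⟩ s

  record IsBranchingBisim (R : S → S → Set) : Set where
    field
      symmetric : ∀ {s t} → R s t → R t s
      transfer  : ∀ {s t α s'} → R s t → s ⟶[ α ] s' →
                  ∃[ t̂ ] ∃[ t' ] ((t ⇒ t̂) × (t̂ ⟶⟨ α ⟩ t') × R s t̂ × R s' t')

  BranchingBisimilar : S → S → Set₁
  BranchingBisimilar s t = ∃[ R ] (IsBranchingBisim R × R s t)

BranchingBisimilarIn : ∀ {n A} (𝒮 : FTS n A) → Product n → FTS.S 𝒮 → FTS.S 𝒮 → Set₁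
BranchingBisimilarIn 𝒮 P = LTSDefs.BranchingBisimilar (λ s α s' → s —[ α ]→[ P ] s')
  where open FTSDefs 𝒮

_⊢_≃bf[_]_ : ∀ {n A} (𝒮 : FTS n A) → FTS.S 𝒮 → ProductSet n → FTS.S 𝒮 → Set₁
𝒮 ⊢ s ≃bf[ 𝒫 ] t = FTSDefs.BranchingFeatureBisimilar 𝒮 𝒫 s t

module Submission where

-- (⇒) A branching feature bisimulation R restricts, for a fixed product P,
--     to the relation  s R_P t :⇔ R(s,φ,t) for some φ with P ⊨ φ.  Every
--     transition of the projection 𝒮_P comes from a feature transition whose
--     constraint P satisfies, so the covering disjunction of the transfer
--     clause yields one witness that P satisfies; its conjuncts show that the
--     witness's τ-path, move and related pairs all live in 𝒮_P.
-- (⇐) Given branching bisimulations B_P of the projections, glue them into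
--     R(s,φ,t) :⇔ B_P(s,t) for all products P ∈ 𝒫 with P ⊨ φ.  To answer a
--     transition s —α|ψ→ s', every product P satisfying φ ∧ ψ gets its own
--     witness, obtained from B_P and annotated with the characteristic
--     formula χ P (true exactly in P).  There are finitely many products, so
--     listing these witnesses over an enumeration of all products gives the
--     finite disjunction the definition asks for.

open import Defs
open import Data.Nat using (ℕ; NonZero; zero; suc)
open import Data.Fin using (Fin)
open import Data.Bool using (Bool; true; false; T?)
open import Data.Bool.Properties using (T-∧; T-∨; T-≡; T-not-≡)
open import Data.Vec using ([]; _∷_; lookup; tabulate)
open import Data.Vec.Properties using (tabulate∘lookup; tabulate-cong)
open import Data.Maybe using (Maybe; just; nothing)
import Data.Maybe.Relation.Unary.Any as MaybeAny
open import Data.List using (List; []; _∷_; foldr; map; allFin; cartesianProductWith; mapMaybe)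
open import Data.List.Membership.Propositional using (_∈_)
open import Data.List.Membership.Propositional.Properties using (∈-allFin; ∈-cartesianProductWith⁺)
open import Data.List.Relation.Unary.Any as Any using (Any; here; there)
open import Data.List.Relation.Unary.Any.Properties using (map⁺; map⁻; mapMaybe⁺)
open import Data.List.Relation.Unary.All as All using (All; []; _∷_)
open import Data.List.Relation.Unary.All.Properties as AllP using ()
open import Data.Product using (Σ; ∃-syntax; _×_; _,_; proj₁; proj₂)
open import Data.Sum using (inj₁; inj₂)
open import Data.Unit using (tt)
open import Data.Empty using (⊥-elim)
open import Function.Bundles using (_⇔_; mk⇔; Equivalence)
open import Relation.Nullary using (yes; no; _×-dec_)
open import Relation.Unary using (Decidable)
open import Relation.Binary.PropositionalEquality using (_≡_; refl; sym; subst; module ≡-Reasoning)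

open Equivalence using (to; from)

⊨-fand : ∀ {n} (P : Product n) (φ ψ : FExp n) → P ⊨ (φ fand ψ) ⇔ (P ⊨ φ × P ⊨ ψ)
⊨-fand P φ ψ = T-∧ {eval P φ}

⊨-fand⁴ : ∀ {n} (P : Product n) (a b c d : FExp n) →
          P ⊨ (a fand b fand c fand d) ⇔ (P ⊨ a × P ⊨ b × P ⊨ c × P ⊨ d)
⊨-fand⁴ P a b c d = mk⇔ split join
  where
  split : P ⊨ (a fand b fand c fand d) → P ⊨ a × P ⊨ b × P ⊨ c × P ⊨ d
  split h = let (pa , pbcd) = to (⊨-fand P a (b fand c fand d)) h
                (pb , pcd)  = to (⊨-fand P b (c fand d)) pbcd
                (pc , pd)   = to (⊨-fand P c d) pcd
            in pa , pb , pc , pd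
  join : P ⊨ a × P ⊨ b × P ⊨ c × P ⊨ d → P ⊨ (a fand b fand c fand d)
  join (pa , pb , pc , pd) =
    from (⊨-fand P a (b fand c fand d)) (pa , from (⊨-fand P b (c fand d)) (pb , from (⊨-fand P c d) (pc , pd)))

⋀ : ∀ {n} → List (FExp n) → FExp n
⋀ = foldr _fand_ ftrue

⊨-⋀⁺ : ∀ {n} {P : Product n} {φs : List (FExp n)} → All (P ⊨_) φs → P ⊨ ⋀ φs
⊨-⋀⁺ []       = tt
⊨-⋀⁺ {P = P} (_∷_ {x = φ} {xs = φs} p ps) = from (⊨-fand P φ (⋀ φs)) (p , ⊨-⋀⁺ ps)

⊨-⋀⁻ : ∀ {n} {P : Product n} (φs : List (FExp n)) → P ⊨ ⋀ φs → All (P ⊨_) φs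
⊨-⋀⁻ []       _ = []
⊨-⋀⁻ {P = P} (φ ∷ φs) h = let (p , ps) = to (⊨-fand P φ (⋀ φs)) h in p ∷ ⊨-⋀⁻ φs ps

-- The finite disjunction ⋁ of Defs (it does not depend on the FTS); it holds
-- in P iff some disjunct does.
⋁ : ∀ {n} → List (FExp n) → FExp n
⋁ = foldr _for_ ffalse

⊨-⋁⁺ : ∀ {n} {P : Product n} {φs : List (FExp n)} → Any (P ⊨_) φs → P ⊨ ⋁ φs
⊨-⋁⁺ {P = P} (here {x = φ} p) = from (T-∨ {eval P φ}) (inj₁ p)
⊨-⋁⁺ {P = P} (there {x = φ} p) = from (T-∨ {eval P φ}) (inj₂ (⊨-⋁⁺ p))

⊨-⋁⁻ : ∀ {n} {P : Product n} (φs : List (FExp n)) → P ⊨ ⋁ φs → Any (P ⊨_) φs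
⊨-⋁⁻ {P = P} (φ ∷ φs) h with to (T-∨ {eval P φ}) h
... | inj₁ p = here p
... | inj₂ p = there (⊨-⋁⁻ φs p)

allProducts : ∀ n → List (Product n)
allProducts zero    = [] ∷ []
allProducts (suc n) = cartesianProductWith _∷_ (true ∷ false ∷ []) (allProducts n)

∈-allProducts : ∀ {n} (P : Product n) → P ∈ allProducts n
∈-allProducts []      = here refl
∈-allProducts (b ∷ P) = ∈-cartesianProductWith⁺ _∷_ (∈-bools b) (∈-allProducts P)
  where
  ∈-bools : ∀ b → b ∈ true ∷ false ∷ []
  ∈-bools true  = here refl
  ∈-bools false = there (here refl)

lit : ∀ {n} → Bool → Fin n → FExp n
lit true  i = fvar i
lit false i = fnot (fvar i)

⊨-lit : ∀ {n} {Q : Product n} (b : Bool) (i : Fin n) → Q ⊨ lit b i ⇔ (lookup Q i ≡ b)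
⊨-lit true  i = T-≡
⊨-lit false i = T-not-≡

χ : ∀ {n} → Product n → FExp n
χ {n} P = ⋀ (map (λ i → lit (lookup P i) i) (allFin n))

χ-self : ∀ {n} (P : Product n) → P ⊨ χ P
χ-self {n} P = ⊨-⋀⁺ {φs = map (λ i → lit (lookup P i) i) (allFin n)} (AllP.map⁺ (All.tabulate (λ {i} _ → from (⊨-lit {Q = P} (lookup P i) i) refl)))

χ-unique : ∀ {n} {P Q : Product n} → Q ⊨ χ P → Q ≡ P
χ-unique {n} {P} {Q} h = begin
  Q                   ≡⟨ sym (tabulate∘lookup Q) ⟩
  tabulate (lookup Q) ≡⟨ tabulate-cong agree ⟩
  tabulate (lookup P) ≡⟨ tabulate∘lookup P ⟩
  P                   ∎
  where
  open ≡-Reasoning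
  agree : ∀ i → lookup Q i ≡ lookup P i
  agree i = to (⊨-lit {Q = Q} (lookup P i) i) (All.lookup (AllP.map⁻ (⊨-⋀⁻ _ h)) (∈-allFin i))

finite-cover : ∀ {n} {W : Set} (f : W → FExp n) {G : Product n → Set} → Decidable G →
               (∀ P → G P → Σ W λ w → P ⊨ f w) →
               Σ (List W) λ ws → ∀ P → G P → P ⊨ ⋁ (map f ws)
finite-cover {n} {W} f {G} G? choose = mapMaybe pick (allProducts n) , covered
  where
  pick : Product n → Maybe W
  pick P with G? P
  ... | yes g = just (proj₁ (choose P g))
  ... | no _  = nothing

  picked : ∀ P → G P → MaybeAny.Any (λ w → P ⊨ f w) (pick P)
  picked P g with G? P
  ... | yes g′ = MaybeAny.just (proj₂ (choose P g′))
  ... | no ¬g  = ⊥-elim (¬g g)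

  covered : ∀ P → G P → P ⊨ ⋁ (map f (mapMaybe pick (allProducts n)))
  covered P g = ⊨-⋁⁺ (map⁺ (mapMaybe⁺ pick (allProducts n)
                  (map⁺ (Any.map (λ { refl → picked P g }) (∈-allProducts P)))))

module _ {n : ℕ} {A : Set} (𝒮 : FTS n A) where
  open FTS 𝒮
  open FTSDefs 𝒮 hiding (⋁)

  module Proj (P : Product n) = LTSDefs (λ s α s' → s —[ α ]→[ P ] s')

  module _ (P : Product n) where
    open Proj P

    lower-⇒ : ∀ {t η t̂} → TauPath t η t̂ → P ⊨ η → t ⇒ t̂
    lower-⇒ nil                           _ = here
    lower-⇒ (cons {η₁ = η₁} {η} step path) h =
      let (p , ps) = to (⊨-fand P η₁ η) h in there (η₁ , step , p) (lower-⇒ path ps)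

    lift-⇒ : ∀ {t t̂} → t ⇒ t̂ → ∃[ η ] (TauPath t η t̂ × P ⊨ η)
    lift-⇒ here                      = ftrue , nil , tt
    lift-⇒ (there (η₁ , step , p) path) =
      let (η , path′ , ps) = lift-⇒ path
      in η₁ fand η , cons step path′ , from (⊨-fand P η₁ η) (p , ps)

    lower-move : ∀ {t̂ α ψ t'} → t̂ —⟨ α ∣ ψ ⟩→ t' → P ⊨ ψ → t̂ ⟶⟨ α ⟩ t'
    lower-move (real step) p = real (_ , step , p)
    lower-move idle        _ = idle

    lift-move : ∀ {t̂ α t'} → t̂ ⟶⟨ α ⟩ t' → ∃[ ψ ] (t̂ —⟨ α ∣ ψ ⟩→ t' × P ⊨ ψ)
    lift-move (real (ψ , step , p)) = ψ , real step , p
    lift-move idle                  = ftrue , idle , tt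

  module _ (𝒫 : ProductSet n) where

    Restrict : (S → FExp n → S → Set) → Product n → S → S → Set
    Restrict R P s t = ∃[ φ ] (R s φ t × P ⊨ φ)

    -- A branching feature bisimulation restricts to a branching bisimulation
    -- of 𝒮_P for every product P ∈ 𝒫: of the witnesses covering φ ∧ ψ, one is
    -- satisfied by P, and all of its ingredients then exist in 𝒮_P.
    restrict : ∀ {R} → IsBranchingFeatureBisim 𝒫 R →
               ∀ {P} → P ∈𝒫 𝒫 → Proj.IsBranchingBisim P (Restrict R P)
    restrict {R} isR {P} P∈𝒫 = record
      { symmetric = λ (φ , r , p) → φ , symmetric r , p
      ; transfer  = transfer-P }
      where
      open IsBranchingFeatureBisim isR
      open Proj P

      transfer-P : ∀ {s t α s'} → Restrict R P s t → s —[ α ]→[ P ] s' →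
                   ∃[ t̂ ] ∃[ t' ] ((t ⇒ t̂) × (t̂ ⟶⟨ α ⟩ t') × Restrict R P s t̂ × Restrict R P s' t')
      transfer-P (φ , r , pφ) (ψ , step , pψ) =
        let (ws , covers) = transfer r step
            P⊨⋁           = covers P P∈𝒫 (from (⊨-fand P φ ψ) (pφ , pψ))
            (w , pw)      = Any.satisfied (map⁻ (⊨-⋁⁻ (map wformula ws) P⊨⋁))
            open Witness w renaming (φ to φ₁; ψ to ψ₁)
            (pη , pψ₁ , pφ₁ , pφ') = to (⊨-fand⁴ P η ψ₁ φ₁ φ') pw
        in t̂ , t' , lower-⇒ P (proj₁ weak) pη , lower-move P move pψ₁
           , (φ₁ , rel , pφ₁) , (φ' , rel' , pφ')

    -- (⇐) Gluing a family of relations B_P on states into a feature relation: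
    -- Glue B (s, φ, t) iff B_P(s, t) for every product P ∈ 𝒫 satisfying φ.
    -- (A record, so that the constraint φ stays inferable from Glue B s φ t.)
    record Glue (B : Product n → S → S → Set) (s : S) (φ : FExp n) (t : S) : Set where
      constructor glued
      field at : ∀ P → P ∈𝒫 𝒫 → P ⊨ φ → B P s t

    -- Under the characteristic formula of P only B_P matters.
    glue-χ : ∀ {B P s t} → B P s t → Glue B s (χ P) t
    glue-χ {B} {P} {s} {t} b = glued λ Q _ Q⊨χP → subst (λ X → B X s t) (sym (χ-unique Q⊨χP)) b

    module _ (B : Product n → S → S → Set)
             (isB : ∀ P → P ∈𝒫 𝒫 → Proj.IsBranchingBisim P (B P)) where

      -- One product P ∈ 𝒫 satisfying φ ∧ ψ: the transfer property of B_P
      -- gives a matching in 𝒮_P, which lifts to a witness guarded by χ P.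
      witness-for : ∀ {s φ t α ψ s'} → Glue B s φ t → s —[ α ∣ ψ ]→ s' →
                    ∀ P → P ∈𝒫 𝒫 × P ⊨ (φ fand ψ) →
                    Σ (Witness (Glue B) s α s' t) λ w → P ⊨ wformula w
      witness-for {φ = φ} {ψ = ψ} g step P (P∈𝒫 , pφψ) =
        let (pφ , pψ) = to (⊨-fand P φ ψ) pφψ
            (t̂ , t' , t⇒t̂ , t̂⟶t' , b , b') =
              Proj.IsBranchingBisim.transfer (isB P P∈𝒫) (Glue.at g P P∈𝒫 pφ) (ψ , step , pψ)
            (η , path , pη)      = lift-⇒ P t⇒t̂
            (ψ' , move , pψ')    = lift-move P t̂⟶t'
        in witness t̂ t' η ψ' (χ P) (χ P) (path , P , pη) move (glue-χ b) (glue-χ b')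
           , from (⊨-fand⁴ P η ψ' (χ P) (χ P)) (pη , pψ' , χ-self P , χ-self P)

      -- The glued relation is a branching feature bisimulation; the finitely
      -- many per-product witnesses together cover φ ∧ ψ.
      glue : IsBranchingFeatureBisim 𝒫 (Glue B)
      glue = record
        { respects  = respects-glued
        ; symmetric = symmetric-glued
        ; transfer  = transfer-glued }
        where
        respects-glued : ∀ {s φ φ₂ t} → φ ∼[ 𝒫 ] φ₂ → Glue B s φ t → Glue B s φ₂ t
        respects-glued φ∼φ₂ g = glued λ P P∈𝒫 pφ₂ → Glue.at g P P∈𝒫 (from (φ∼φ₂ P P∈𝒫) pφ₂)

        symmetric-glued : ∀ {s φ t} → Glue B s φ t → Glue B t φ s
        symmetric-glued g = glued λ P P∈𝒫 pφ →
          Proj.IsBranchingBisim.symmetric (isB P P∈𝒫) (Glue.at g P P∈𝒫 pφ)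

        transfer-glued : ∀ {s φ t α ψ s'} → Glue B s φ t → s —[ α ∣ ψ ]→ s' →
                         Σ (List (Witness (Glue B) s α s' t)) λ ws →
                           ∀ P → P ∈𝒫 𝒫 → P ⊨ (φ fand ψ) → P ⊨ ⋁ (map wformula ws)
        transfer-glued {φ = φ} {ψ = ψ} g step =
          let (ws , covers) = finite-cover wformula
                                (λ P → T? (𝒫 P) ×-dec T? (eval P (φ fand ψ)))
                                (witness-for g step)
          in ws , λ P P∈𝒫 pφψ → covers P (P∈𝒫 , pφψ)

    -- Choosing, for every P ∈ 𝒫, one branching bisimulation of 𝒮_P relating
    -- s₀ and t₀ gives a family of relations indexed by all products (empty
    -- outside 𝒫), each of which is a branching bisimulation of its projection.
    Chosen : ∀ {s₀ t₀} → (∀ P → P ∈𝒫 𝒫 → BranchingBisimilarIn 𝒮 P s₀ t₀) →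
             Product n → S → S → Set
    Chosen bisimilar P s t = Σ (P ∈𝒫 𝒫) λ P∈𝒫 → proj₁ (bisimilar P P∈𝒫) s t

    chosen-isBisim : ∀ {s₀ t₀} (bisimilar : ∀ P → P ∈𝒫 𝒫 → BranchingBisimilarIn 𝒮 P s₀ t₀) →
                     ∀ P → Proj.IsBranchingBisim P (Chosen bisimilar P)
    chosen-isBisim bisimilar P = record
      { symmetric = λ (P∈𝒫 , r) → P∈𝒫 , symmetric (isBisim P∈𝒫) r
      ; transfer  = λ (P∈𝒫 , r) step →
          let (t̂ , t' , t⇒t̂ , t̂⟶t' , r̂ , r') = transfer (isBisim P∈𝒫) r step
          in t̂ , t' , t⇒t̂ , t̂⟶t' , (P∈𝒫 , r̂) , (P∈𝒫 , r') }
      where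
      open Proj.IsBranchingBisim
      isBisim : (P∈𝒫 : P ∈𝒫 𝒫) → Proj.IsBranchingBisim P (proj₁ (bisimilar P P∈𝒫))
      isBisim P∈𝒫 = proj₁ (proj₂ (bisimilar P P∈𝒫))

theorem6 : ∀ {n : ℕ} .{{_ : NonZero n}} {A : Set} (𝒫 : ProductSet n) (𝒮 : FTS n A)
             (s t : FTS.S 𝒮) →
             (𝒮 ⊢ s ≃bf[ 𝒫 ] t) ⇔ (∀ P → P ∈𝒫 𝒫 → BranchingBisimilarIn 𝒮 P s t)
theorem6 𝒫 𝒮 s t = mk⇔ project assemble
  where
  -- Restrict the feature bisimulation to each product; true holds everywhere.
  project : 𝒮 ⊢ s ≃bf[ 𝒫 ] t → ∀ P → P ∈𝒫 𝒫 → BranchingBisimilarIn 𝒮 P s t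
  project (R , isR , Rst) P P∈𝒫 =
    Restrict 𝒮 𝒫 R P , restrict 𝒮 𝒫 isR P∈𝒫 , (ftrue , Rst , tt)

  assemble : (∀ P → P ∈𝒫 𝒫 → BranchingBisimilarIn 𝒮 P s t) → 𝒮 ⊢ s ≃bf[ 𝒫 ] t
  assemble bisimilar =
    Glue 𝒮 𝒫 (Chosen 𝒮 𝒫 bisimilar) ,
    glue 𝒮 𝒫 (Chosen 𝒮 𝒫 bisimilar) (λ P _ → chosen-isBisim 𝒮 𝒫 bisimilar P) ,
    glued (λ P P∈𝒫 _ → P∈𝒫 , proj₂ (proj₂ (bisimilar P P∈𝒫)))
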